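{- Let $k\ge4$, $G$, $\mathcal S$, $\mathcal Q$, $\alpha$ and the token assignment be as described in the context. Every regular $3$-star of $\mathcal S$ receives in total (summing over its vertices) at least $\alpha+\frac{1-\alpha}{k-1}$ token.
   Context: $G=(V,E)$ is a simple undirected graph, $k\ge4$ an integer. A star in $G$ is a subgraph that is a single vertex, a single edge, or a tree with exactly one vertex of degree $\ge2$ and all others of degree $1$; an $\ell$-star has exactly $\ell$ vertices, an $\ell^-$-star at most $\ell$, an $\ell^+$-star at least $\ell$. The center of a star is its vertex of maximum degree (in a $2$-star one vertex is designated as center, arbitrarily but fixed); the others are satellites. We write $v_1$-$v_2\ldots v_\ell$ for the star with center $v_1$ and satellites $v_2,\dots,v_\ell$. A $k^-$-star partition of $G$ is a collection of vertex-disjoint $k^-$-stars covering $V$. Operations on a partition $\mathcal S$ (critical vertices are vertices in a $2$-star of $\mathcal S$ or centers of $3$-stars of $\mathcal S$; separate critical vertices lie in different stars of $\mathcal S$): Op.1: for $\{u,v\}\in E$ with $u$ in a $2$-star and $v$ a satellite of a $4^+$-star centered at $c$, replace $\{c,v\}$ by $\{u,v\}$. Op.2: for a star $v_1$-$v_2\ldots v_\ell$ of $\mathcal S$ ($\ell\in\{2,3,4\}$) and pairwise separate critical vertices $w_1,\dots,w_\ell$ outside it with $\{v_j,w_j\}\in E$, replace its edges by $\{v_j,w_j\}$. Op.3: for a $2$- or $3$-star $S=v_1$-$v_2\ldots v_\ell$ and a $2$-star $W=w_1$-$w_2\neq S$ with $w_1,w_2$ adjacent to $v_1$: if $k\ge5$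 or $\ell=2$ replace $\{w_1,w_2\}$ by $\{w_1,v_1\},\{w_2,v_1\}$; if $k=4,\ell=3$ and some critical $w_3\notin V(S)\cup V(W)$ is adjacent to $v_j$, $j\in\{2,3\}$, replace $\{w_1,w_2\},\{v_1,v_j\}$ by $\{w_1,v_1\},\{w_2,v_1\},\{w_3,v_j\}$. Standing assumptions: $\mathcal S$ is a $k^-$-star partition of $G$ with the minimum possible number of $1$-stars among all $k^-$-star partitions of $G$ and to which none of Operations 1–3 is applicable (equivalently, a possible output of the paper's algorithm). $\mathcal Q$ is a fixed optimal $k^-$-star partition (minimum number of stars), with a fixed center for each of its $2$-stars. A vertex is a center (satellite) of $\mathcal Q$ if it is the center (a satellite) of some star of $\mathcal Q$; an edge of $\mathcal Q$ is an edge of some star of $\mathcal Q$. "Critical" is with respect to $\mathcal S$. Special and regular stars: a $3$-star $S=v_1$-$v_2v_3$ of $\mathcal S$ is special if there is a $2$-star $W=w_1$-$w_2$ of $\mathcal S$ such that (C1) $v_1$ is a satellite of $\mathcal Q$ and $v_2,v_3$ are centers of $\mathcal Q$, and (C2) there are $v_i,v_j\in V(S)$ with $\{v_i,w_1\}$ and $\{v_j,w_2\}$ edges of $\mathcal Q$. A $2$-star $S=v_1$-$v_2$ of $\mathcal S$ is special if $v_1,v_2$ are both satellites of $\mathcal Q$ and either (C3) $k=4$ and there is a $3$-star of $\mathcal S$ with center $w$ such that $\{v_1,w\},\{v_2,w\}$ are edges of $\mathcal Q$, or (C4) there is a $2$-star $W=w_1$-$w_2$ of $\mathcal S$ with $\{v_1,w_1\},\{v_2,w_2\}$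 edges of $\mathcal Q$. A $2$- or $3$-star of $\mathcal S$ is regular if it is not special. Let $\alpha=\frac{2k-3}{2k^2-4k+1}$. Tokens: the vertex of each $1$-star of $\mathcal Q$ gets $\alpha$. For a $j$-star $v_1$-$v_2\ldots v_j$ of $\mathcal Q$ with $2\le j\le k$: (1) if $v_1$ is critical, $v_1$ gets $\alpha$ and each $v_i$ ($i\ge2$) gets $\frac{1-\alpha}{j-1}$; (2) if $v_1$ is not critical but some satellite is, each $v_i$ ($i\ge2$) gets $\alpha$ and $v_1$ gets $1-(j-1)\alpha$; (3) if no vertex of it is critical, each vertex gets $\frac1j$. -}

module Defs where

open import Data.Nat as ℕ using (ℕ; zero; suc; _≤_; _∸_)
open import Data.Fin as Fin using (Fin)
open import Data.Bool using (Bool; true; false; T; _∧_; _∨_; if_then_else_; not)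
open import Data.List using (List; []; _∷_; length; map; foldr; filter; concatMap)
open import Data.Bool.ListAction using (any)
open import Data.List.Membership.Propositional using (_∈_; _∉_)
open import Data.List.Relation.Unary.All using (All)
open import Data.List.Relation.Unary.AllPairs using (AllPairs)
open import Data.List.Relation.Unary.Unique.Propositional using (Unique)
open import Data.List.Relation.Binary.Pointwise using (Pointwise)
open import Data.Product using (Σ; ∃; ∃-syntax; _×_; _,_)
open import Data.Sum using (_⊎_)
open import Data.Integer using (+_)
open import Data.Rational using (ℚ; _/_; 0ℚ; 1ℚ; _+_; _-_; _*_; _≤_)
open import Relation.Nullary using (¬_; does)
open import Relation.Binary.PropositionalEquality using (_≡_; _≢_)

record Graph (n : ℕ) : Set₁ where
  field
    Adj    : Fin n → Fin n → Set
    sym    : ∀ {u v} → Adj u v → Adj v u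
    irrefl : ∀ {u} → ¬ Adj u u
open Graph public

-- Stars: a center together with its list of satellites.
-- The edges of the star are exactly {center, s} for s a satellite.
-- (For a 2-star this fixes the designated center.)

record Star (n : ℕ) : Set where
  constructor _─_
  field
    center : Fin n
    sats   : List (Fin n)
open Star public

verts : ∀ {n} → Star n → List (Fin n)
verts s = center s ∷ sats s

size : ∀ {n} → Star n → ℕ
size s = suc (length (sats s))

IsStarIn : ∀ {n} → Graph n → Star n → Set
IsStarIn G s = All (Adj G (center s)) (sats s) × Unique (verts s)

IsStarPartition : ∀ {n} → Graph n → ℕ → List (Star n) → Set
IsStarPartition {n} G k P =
  All (IsStarIn G) P × All (λ s → size s ℕ.≤ k) P
  × Unique (concatMap verts P) × (∀ (v : Fin n) → v ∈ concatMap verts P)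

num1Stars : ∀ {n} → List (Star n) → ℕ
num1Stars P = length (filter (λ s → length (sats s) ℕ.≟ 0) P)

_∈ᵇ_ : ∀ {n} → Fin n → List (Fin n) → Bool
x ∈ᵇ xs = any (λ y → does (x Fin.≟ y)) xs

isCrit : ∀ {n} → List (Star n) → Fin n → Bool
isCrit S x = any (λ s → (does (size s ℕ.≟ 2) ∧ (x ∈ᵇ verts s))
                      ∨ (does (size s ℕ.≟ 3) ∧ does (center s Fin.≟ x))) S

Critical : ∀ {n} → List (Star n) → Fin n → Set
Critical S x = T (isCrit S x)

Separate : ∀ {n} → List (Star n) → Fin n → Fin n → Set
Separate S x y = ∀ s → s ∈ S → ¬ (x ∈ verts s × y ∈ verts s)

Op1Applicable : ∀ {n} → Graph n → List (Star n) → Set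
Op1Applicable G S =
  ∃[ u ] ∃[ v ] Adj G u v
    × (∃[ s ] s ∈ S × size s ≡ 2 × u ∈ verts s)
    × (∃[ t ] t ∈ S × 4 ℕ.≤ size t × v ∈ sats t)

Op2Applicable : ∀ {n} → Graph n → List (Star n) → Set
Op2Applicable G S =
  ∃[ s ] s ∈ S × (size s ≡ 2 ⊎ size s ≡ 3 ⊎ size s ≡ 4)
    × ∃[ ws ] Pointwise (Adj G) (verts s) ws
              × All (Critical S) ws
              × All (λ w → w ∉ verts s) ws
              × AllPairs (Separate S) ws

Op3Applicable : ∀ {n} → ℕ → Graph n → List (Star n) → Set
Op3Applicable k G S =
  ∃[ s ] s ∈ S × (size s ≡ 2 ⊎ size s ≡ 3)
    × ∃[ w₁ ] ∃[ w₂ ] (w₁ ─ (w₂ ∷ [])) ∈ S × s ≢ (w₁ ─ (w₂ ∷ []))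
      × Adj G w₁ (center s) × Adj G w₂ (center s)
      × ( (5 ℕ.≤ k ⊎ size s ≡ 2)
        ⊎ (k ≡ 4 × size s ≡ 3
           × ∃[ w₃ ] ∃[ vj ] Critical S w₃ × w₃ ∉ verts s
               × w₃ ∉ (w₁ ∷ w₂ ∷ []) × vj ∈ sats s × Adj G w₃ vj))

IsQCenter : ∀ {n} → List (Star n) → Fin n → Set
IsQCenter Q x = ∃[ t ] t ∈ Q × center t ≡ x

IsQSat : ∀ {n} → List (Star n) → Fin n → Set
IsQSat Q x = ∃[ t ] t ∈ Q × x ∈ sats t

QEdge : ∀ {n} → List (Star n) → Fin n → Fin n → Set
QEdge Q x y = ∃[ t ] t ∈ Q × ((center t ≡ x × y ∈ sats t) ⊎ (center t ≡ y × x ∈ sats t))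

Special3 : ∀ {n} → List (Star n) → List (Star n) → Star n → Set
Special3 S Q s =
  ∃[ v₁ ] ∃[ v₂ ] ∃[ v₃ ] s ≡ (v₁ ─ (v₂ ∷ v₃ ∷ []))
    × ∃[ w₁ ] ∃[ w₂ ] (w₁ ─ (w₂ ∷ [])) ∈ S
      × (IsQSat Q v₁ × IsQCenter Q v₂ × IsQCenter Q v₃)
      × (∃[ vi ] ∃[ vj ] vi ∈ verts s × vj ∈ verts s × QEdge Q vi w₁ × QEdge Q vj w₂)

-- recip m = 1/m for m ≥ 1 (only used with m ≥ 1)
recip : ℕ → ℚ
recip zero    = 0ℚ
recip (suc m) = + 1 / suc m

ℕtoℚ : ℕ → ℚ
ℕtoℚ m = + m / 1

-- α = (2k-3)/(2k²-4k+1)   (the ∸ are exact for k ≥ 2)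
α : ℕ → ℚ
α k = + (2 ℕ.* k ∸ 3) / suc (2 ℕ.* k ℕ.* k ∸ 4 ℕ.* k)

sumℚ : List ℚ → ℚ
sumℚ = foldr _+_ 0ℚ

tokFrom : ∀ {n} → ℕ → List (Star n) → Star n → Fin n → ℚ
tokFrom k S t x with sats t
... | [] = if does (center t Fin.≟ x) then α k else 0ℚ
... | sat@(_ ∷ _) =
  let m = length sat in
  if isCrit S (center t) then
     (if does (center t Fin.≟ x) then α k
      else if x ∈ᵇ sat then (1ℚ - α k) * recip m else 0ℚ)
  else if any (isCrit S) sat then
     (if does (center t Fin.≟ x) then 1ℚ - ℕtoℚ m * α k
      else if x ∈ᵇ sat then α k else 0ℚ)
  else
     (if (does (center t Fin.≟ x) ∨ (x ∈ᵇ sat)) then recip (suc m) else 0ℚ)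

-- token of vertex x: contribution of the (unique) star of Q containing x
token : ∀ {n} → ℕ → List (Star n) → List (Star n) → Fin n → ℚ
token k S Q x = sumℚ (map (λ t → tokFrom k S t x) Q)

starToken : ∀ {n} → ℕ → List (Star n) → List (Star n) → Star n → ℚ
starToken k S Q s = sumℚ (map (token k S Q) (verts s))

{-# OPTIONS --safe #-}
-- The centre v₁ of a 3-star v₁-v₂v₃ of S is critical and its satellites v₂, v₃ are not.
-- By the token rules a critical vertex receives at least α, unless it is a satellite of a
-- k-star of Q with critical centre, where it receives (1-α)/(k-1); a non-critical vertex
-- receives at least (1-α)/(k-1), unless it is the centre of a star of Q with a critical
-- satellite, where it still receives at least 1-(k-1)α. As (1-α)/(k-1) = 2(1-(k-1)α) and
-- α ≤ (1-α)/(k-1) + 1-(k-1)α, the three tokens sum to at least α + (1-α)/(k-1) unless all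
-- three vertices are exceptional. Then v₁, v₂, v₃ are joined by edges of Q to critical
-- vertices c, w₂, w₃, which are distinct and lie outside the star. Two distinct critical vertices in
-- a common star of S form a 2-star of S, and such a 2-star would make v₁-v₂v₃ special; so
-- c, w₂, w₃ are pairwise separate and Operation 2 applies to v₁-v₂v₃, a contradiction.
module Submission where

open import Defs hiding (sym)
open import Data.Nat as ℕ using (ℕ; suc; _∸_; s≤s; z≤n)
import Data.Nat.Properties as ℕ
open import Data.Nat.Tactic.RingSolver using (solve-∀)
open import Data.Integer as ℤ using (+_)
import Data.Integer.Properties as ℤ
open import Data.Fin as Fin using (Fin)
open import Data.Bool using (Bool; true; false; T; if_then_else_; _∨_)
open import Data.Bool.Properties using (T-≡; T-∨; T-∧)
open import Data.Bool.ListAction using (any)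
open import Data.List using (List; []; _∷_; _++_; length; concatMap)
open import Data.List.Membership.Propositional using (_∈_; _∉_; find; lose)
open import Data.List.Membership.Propositional.Properties using (∈-++⁺ʳ; ∈-concatMap⁺; ∈-concatMap⁻)
import Data.List.Membership.DecPropositional as DecMembership
open import Data.List.Relation.Unary.Any as Any using (here; there)
open import Data.List.Relation.Unary.Any.Properties using (any⁺; any⁻)
open import Data.List.Relation.Unary.All as All using (All; _∷_; [])
open import Data.List.Relation.Unary.All.Properties using (All¬⇒¬Any)
open import Data.List.Relation.Unary.AllPairs using (AllPairs; _∷_; [])
open import Data.List.Relation.Unary.Unique.Propositional using (Unique)
open import Data.List.Relation.Binary.Pointwise using (Pointwise; _∷_; [])
open import Data.Product using (∃-syntax; _×_; _,_; proj₁; proj₂)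
open import Data.Sum using (_⊎_; inj₁; inj₂)
open import Data.Empty using (⊥; ⊥-elim)
open import Data.Rational using (ℚ; _/_; _+_; _-_; _*_; _≤_; 0ℚ; 1ℚ; toℚᵘ; NonNegative)
open import Data.Rational.Properties
  using (toℚᵘ-injective; toℚᵘ-cancel-≤; toℚᵘ-fromℚᵘ; toℚᵘ-homo-+; toℚᵘ-homo-*; normalize-nonNeg;
         +-identityˡ; +-identityʳ; +-monoʳ-≤; +-monoˡ-≤; +-mono-≤; +-comm; +-assoc;
         ≤-reflexive; ≤-trans; neg-antimono-≤; *-monoˡ-≤-nonNeg; *-monoʳ-≤-nonNeg; module ≤-Reasoning)
open import Data.Rational.Solver using (module +-*-Solver)
open import Data.Rational.Unnormalised as ℚᵘ using (mkℚᵘ; _≃_; *≡*; *≤*)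
import Data.Rational.Unnormalised.Properties as ℚᵘ
open import Function using (Equivalence; _∘_; case_of_)
open import Relation.Nullary using (¬_; Dec; does; yes; no)
open import Relation.Nullary.Decidable using (dec-true; dec-false; _×-dec_)
open import Relation.Binary.PropositionalEquality

private
  variable
    A : Set
    x : A
    xs ys : List A

does⁺ : {P : Set} (P? : Dec P) → P → T (does P?)
does⁺ (yes _) _ = _
does⁺ (no ¬p) p = ¬p p

does⁻ : {P : Set} (P? : Dec P) → T (does P?) → P
does⁻ (yes p) _ = p

¬T⇒≡false : ∀ {b} → ¬ T b → b ≡ false
¬T⇒≡false {false} _ = refl
¬T⇒≡false {true} ¬t = ⊥-elim (¬t _)

if-elim : ∀ (P : A → Set) b {u v} → (b ≡ true → P u) → (b ≡ false → P v) → P (if b then u else v)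
if-elim P true  p _ = p refl
if-elim P false _ p = p refl

if-both : ∀ (P : A → Set) b {u v} → P u → P v → P (if b then u else v)
if-both P true  p _ = p
if-both P false _ p = p

Unique-++⇒∉ : ∀ xs → Unique (xs ++ ys) → x ∈ xs → x ∉ ys
Unique-++⇒∉ (_ ∷ xs) (x∉ ∷ _) (here refl) x∈ys = All.lookup x∉ (∈-++⁺ʳ xs x∈ys) refl
Unique-++⇒∉ (_ ∷ xs) (_ ∷ u) (there x∈xs) = Unique-++⇒∉ xs u x∈xs

Unique-++⁻ʳ : ∀ xs → Unique (xs ++ ys) → Unique ys
Unique-++⁻ʳ [] u = u
Unique-++⁻ʳ (_ ∷ xs) (_ ∷ u) = Unique-++⁻ʳ xs u

-- Fractions n / (a + 1)

toℚᵘ-/ : ∀ n a → toℚᵘ (+ n / suc a) ≃ mkℚᵘ (+ n) a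
toℚᵘ-/ n a = toℚᵘ-fromℚᵘ (mkℚᵘ (+ n) a)

/-≤ : ∀ n a m b → n ℕ.* suc b ℕ.≤ m ℕ.* suc a → + n / suc a ≤ + m / suc b
/-≤ n a m b le = toℚᵘ-cancel-≤
  (ℚᵘ.≤-respʳ-≃ (ℚᵘ.≃-sym (toℚᵘ-/ m b)) (ℚᵘ.≤-respˡ-≃ (ℚᵘ.≃-sym (toℚᵘ-/ n a))
    (*≤* (subst₂ ℤ._≤_ (ℤ.pos-* n (suc b)) (ℤ.pos-* m (suc a)) (ℤ.+≤+ le)))))

/-≡ : ∀ n a m b → n ℕ.* suc b ≡ m ℕ.* suc a → + n / suc a ≡ + m / suc b
/-≡ n a m b eq = toℚᵘ-injective (ℚᵘ.≃-trans (toℚᵘ-/ n a) (ℚᵘ.≃-trans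
  (*≡* (trans (sym (ℤ.pos-* n (suc b))) (trans (cong +_ eq) (ℤ.pos-* m (suc a)))))
  (ℚᵘ.≃-sym (toℚᵘ-/ m b))))

/-+ : ∀ n a m b → + n / suc a + + m / suc b ≡ + (n ℕ.* suc b ℕ.+ m ℕ.* suc a) / (suc a ℕ.* suc b)
/-+ n a m b = toℚᵘ-injective (begin
  toℚᵘ (+ n / suc a + + m / suc b)            ≈⟨ toℚᵘ-homo-+ (+ n / suc a) (+ m / suc b) ⟩
  toℚᵘ (+ n / suc a) ℚᵘ.+ toℚᵘ (+ m / suc b)  ≈⟨ ℚᵘ.+-cong (toℚᵘ-/ n a) (toℚᵘ-/ m b) ⟩
  mkℚᵘ (+ n) a ℚᵘ.+ mkℚᵘ (+ m) b              ≡⟨ cong (λ z → mkℚᵘ z (b ℕ.+ a ℕ.* suc b)) numerator ⟩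
  mkℚᵘ (+ N) (b ℕ.+ a ℕ.* suc b)              ≈⟨ ℚᵘ.≃-sym (toℚᵘ-/ N (b ℕ.+ a ℕ.* suc b)) ⟩
  toℚᵘ (+ N / (suc a ℕ.* suc b)) ∎)
  where
  open ℚᵘ.≃-Reasoning
  N : ℕ
  N = n ℕ.* suc b ℕ.+ m ℕ.* suc a
  numerator : + n ℤ.* + suc b ℤ.+ + m ℤ.* + suc a ≡ + N
  numerator = sym (trans (ℤ.pos-+ (n ℕ.* suc b) (m ℕ.* suc a))
                         (cong₂ ℤ._+_ (ℤ.pos-* n (suc b)) (ℤ.pos-* m (suc a))))

/-* : ∀ n a m b → + n / suc a * (+ m / suc b) ≡ + (n ℕ.* m) / (suc a ℕ.* suc b)
/-* n a m b = toℚᵘ-injective (begin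
  toℚᵘ (+ n / suc a * (+ m / suc b))          ≈⟨ toℚᵘ-homo-* (+ n / suc a) (+ m / suc b) ⟩
  toℚᵘ (+ n / suc a) ℚᵘ.* toℚᵘ (+ m / suc b)  ≈⟨ ℚᵘ.*-cong (toℚᵘ-/ n a) (toℚᵘ-/ m b) ⟩
  mkℚᵘ (+ n) a ℚᵘ.* mkℚᵘ (+ m) b              ≡⟨ cong (λ z → mkℚᵘ z (b ℕ.+ a ℕ.* suc b)) (sym (ℤ.pos-* n m)) ⟩
  mkℚᵘ (+ (n ℕ.* m)) (b ℕ.+ a ℕ.* suc b)      ≈⟨ ℚᵘ.≃-sym (toℚᵘ-/ (n ℕ.* m) (b ℕ.+ a ℕ.* suc b)) ⟩
  toℚᵘ (+ (n ℕ.* m) / (suc a ℕ.* suc b)) ∎)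
  where open ℚᵘ.≃-Reasoning

/-mono-≤ : ∀ {n m} a → n ℕ.≤ m → + n / suc a ≤ + m / suc a
/-mono-≤ {n} {m} a n≤m = /-≤ n a m a (ℕ.*-monoˡ-≤ (suc a) n≤m)

/-+-same : ∀ n m a → + n / suc a + + m / suc a ≡ + (n ℕ.+ m) / suc a
/-+-same n m a = trans (/-+ n a m a)
  (sym (/-≡ (n ℕ.+ m) a (n ℕ.* suc a ℕ.+ m ℕ.* suc a) (a ℕ.+ a ℕ.* suc a) (rescale n m a)))
  where
  rescale : ∀ n m a → (n ℕ.+ m) ℕ.* (suc a ℕ.* suc a) ≡ (n ℕ.* suc a ℕ.+ m ℕ.* suc a) ℕ.* suc a
  rescale = solve-∀

1-/ : ∀ n m a → n ℕ.+ m ≡ suc a → 1ℚ - + n / suc a ≡ + m / suc a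
1-/ n m a eq = begin
  1ℚ - p                 ≡⟨ cong (_- p) one ⟩
  (+ m / suc a + p) - p  ≡⟨ cancel (+ m / suc a) p ⟩
  + m / suc a ∎
  where
  open ≡-Reasoning
  p : ℚ
  p = + n / suc a
  one : 1ℚ ≡ + m / suc a + p
  one = trans (/-≡ 1 0 (m ℕ.+ n) a scale) (sym (/-+-same m n a))
    where
    scale : 1 ℕ.* suc a ≡ (m ℕ.+ n) ℕ.* 1
    scale = begin
      1 ℕ.* suc a      ≡⟨ ℕ.*-identityˡ (suc a) ⟩
      suc a            ≡⟨ trans (sym eq) (ℕ.+-comm n m) ⟩
      m ℕ.+ n          ≡⟨ sym (ℕ.*-identityʳ (m ℕ.+ n)) ⟩
      (m ℕ.+ n) ℕ.* 1 ∎
  cancel : ∀ q r → (q + r) - r ≡ q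
  cancel = solve 2 (λ q r → (q :+ r) :- r := q) refl
    where open +-*-Solver

ℕtoℚ-*-/ : ∀ n m a → ℕtoℚ n * (+ m / suc a) ≡ + (n ℕ.* m) / suc a
ℕtoℚ-*-/ n m a = trans (/-* n 0 m a)
  (/-≡ (n ℕ.* m) (a ℕ.+ 0) (n ℕ.* m) a (cong (n ℕ.* m ℕ.*_) (sym (ℕ.+-identityʳ (suc a)))))

/-*-recip : ∀ n a q r → n ≡ q ℕ.* suc r → + n / suc a * recip (suc r) ≡ + q / suc a
/-*-recip n a q r eq = trans (/-* n a 1 r) (/-≡ (n ℕ.* 1) (r ℕ.+ a ℕ.* suc r) q a cancel)
  where
  cancel : n ℕ.* 1 ℕ.* suc a ≡ q ℕ.* (suc a ℕ.* suc r)
  cancel = begin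
    n ℕ.* 1 ℕ.* suc a        ≡⟨ cong (ℕ._* suc a) (trans (ℕ.*-identityʳ n) eq) ⟩
    q ℕ.* suc r ℕ.* suc a    ≡⟨ ℕ.*-assoc q (suc r) (suc a) ⟩
    q ℕ.* (suc r ℕ.* suc a)  ≡⟨ cong (q ℕ.*_) (ℕ.*-comm (suc r) (suc a)) ⟩
    q ℕ.* (suc a ℕ.* suc r) ∎
    where open ≡-Reasoning

recip-antitone : ∀ {m n} → 1 ℕ.≤ m → m ℕ.≤ n → recip n ≤ recip m
recip-antitone {suc m} {suc n} _ m≤n = /-≤ 1 n 1 m (ℕ.*-monoʳ-≤ 1 m≤n)

ℕtoℚ-mono : ∀ {m n} → m ℕ.≤ n → ℕtoℚ m ≤ ℕtoℚ n
ℕtoℚ-mono {m} {n} m≤n = /-≤ m 0 n 0 (ℕ.*-monoˡ-≤ 1 m≤n)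

-- Token values

-- By rule (1) each satellite of an (m+1)-star of Q with critical centre receives satShare k m;
-- by rule (2) the non-critical centre of an (m+1)-star of Q with a critical satellite receives
-- centerShare k m. The smallest values, for k-stars, are fullSatToken k and fullCenterToken k.
satShare centerShare : ℕ → ℕ → ℚ
satShare k m = (1ℚ - α k) * recip m
centerShare k m = 1ℚ - ℕtoℚ m * α k

fullSatToken fullCenterToken : ℕ → ℚ
fullSatToken k = satShare k (k ∸ 1)
fullCenterToken k = centerShare k (k ∸ 1)

-- For k = 2 + m, the denominator 2k² - 4k + 1 of α k is d + 1.
module TokenValues (m : ℕ) where

  d : ℕ
  d = 2 ℕ.* m ℕ.* m ℕ.+ 4 ℕ.* m

  α-value : α (2 ℕ.+ m) ≡ + (1 ℕ.+ 2 ℕ.* m) / suc d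
  α-value = cong₂ (λ p q → + p / suc q)
    (trans (cong (_∸ 3) (numerator m)) (ℕ.m+n∸m≡n 3 (1 ℕ.+ 2 ℕ.* m)))
    (trans (cong (_∸ 4 ℕ.* (2 ℕ.+ m)) (denominator m)) (ℕ.m+n∸m≡n (4 ℕ.* (2 ℕ.+ m)) d))
    where
    numerator : ∀ m → 2 ℕ.* (2 ℕ.+ m) ≡ 3 ℕ.+ (1 ℕ.+ 2 ℕ.* m)
    numerator = solve-∀
    denominator : ∀ m → 2 ℕ.* (2 ℕ.+ m) ℕ.* (2 ℕ.+ m) ≡ 4 ℕ.* (2 ℕ.+ m) ℕ.+ (2 ℕ.* m ℕ.* m ℕ.+ 4 ℕ.* m)
    denominator = solve-∀

  1-α-value : 1ℚ - α (2 ℕ.+ m) ≡ + (2 ℕ.* m ℕ.* (1 ℕ.+ m)) / suc d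
  1-α-value = trans (cong (λ p → 1ℚ - p) α-value)
    (1-/ (1 ℕ.+ 2 ℕ.* m) (2 ℕ.* m ℕ.* (1 ℕ.+ m)) d (complement m))
    where
    complement : ∀ m → 1 ℕ.+ 2 ℕ.* m ℕ.+ 2 ℕ.* m ℕ.* (1 ℕ.+ m) ≡ suc (2 ℕ.* m ℕ.* m ℕ.+ 4 ℕ.* m)
    complement = solve-∀

  satShare-value : ∀ q r → 2 ℕ.* m ℕ.* (1 ℕ.+ m) ≡ q ℕ.* suc r
    → satShare (2 ℕ.+ m) (suc r) ≡ + q / suc d
  satShare-value q r eq =
    trans (cong (_* recip (suc r)) 1-α-value) (/-*-recip (2 ℕ.* m ℕ.* (1 ℕ.+ m)) d q r eq)

  fullSatToken-value : fullSatToken (2 ℕ.+ m) ≡ + (2 ℕ.* m) / suc d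
  fullSatToken-value = satShare-value (2 ℕ.* m) m refl

  fullCenterToken-value : fullCenterToken (2 ℕ.+ m) ≡ + m / suc d
  fullCenterToken-value = begin
    1ℚ - ℕtoℚ (1 ℕ.+ m) * α (2 ℕ.+ m)
      ≡⟨ cong (λ p → 1ℚ - ℕtoℚ (1 ℕ.+ m) * p) α-value ⟩
    1ℚ - ℕtoℚ (1 ℕ.+ m) * (+ (1 ℕ.+ 2 ℕ.* m) / suc d)
      ≡⟨ cong (λ p → 1ℚ - p) (ℕtoℚ-*-/ (1 ℕ.+ m) (1 ℕ.+ 2 ℕ.* m) d) ⟩
    1ℚ - + ((1 ℕ.+ m) ℕ.* (1 ℕ.+ 2 ℕ.* m)) / suc d
      ≡⟨ 1-/ ((1 ℕ.+ m) ℕ.* (1 ℕ.+ 2 ℕ.* m)) m d (complement m) ⟩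
    + m / suc d ∎
    where
    open ≡-Reasoning
    complement : ∀ m → (1 ℕ.+ m) ℕ.* (1 ℕ.+ 2 ℕ.* m) ℕ.+ m ≡ suc (2 ℕ.* m ℕ.* m ℕ.+ 4 ℕ.* m)
    complement = solve-∀

α-nonNeg : ∀ k → NonNegative (α k)
α-nonNeg k = normalize-nonNeg (2 ℕ.* k ∸ 3) (suc (2 ℕ.* k ℕ.* k ∸ 4 ℕ.* k))

1-α-nonNeg : ∀ {k} → 2 ℕ.≤ k → NonNegative (1ℚ - α k)
1-α-nonNeg {suc (suc m)} (s≤s (s≤s _)) =
  subst NonNegative (sym 1-α-value) (normalize-nonNeg (2 ℕ.* m ℕ.* (1 ℕ.+ m)) (suc d))
  where open TokenValues m

satShare-antitone : ∀ {k r s} → 2 ℕ.≤ k → 1 ℕ.≤ r → r ℕ.≤ s → satShare k s ≤ satShare k r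
satShare-antitone {k} 2≤k 1≤r r≤s =
  *-monoˡ-≤-nonNeg (1ℚ - α k) {{1-α-nonNeg 2≤k}} (recip-antitone 1≤r r≤s)

fullSatToken≤α : ∀ {k} → 2 ℕ.≤ k → fullSatToken k ≤ α k
fullSatToken≤α {suc (suc m)} (s≤s (s≤s _)) = begin
  fullSatToken (2 ℕ.+ m)     ≡⟨ fullSatToken-value ⟩
  + (2 ℕ.* m) / suc d        ≤⟨ /-mono-≤ d (ℕ.n≤1+n (2 ℕ.* m)) ⟩
  + (1 ℕ.+ 2 ℕ.* m) / suc d  ≡⟨ sym α-value ⟩
  α (2 ℕ.+ m) ∎
  where open TokenValues m; open ≤-Reasoning

α≤satShare : ∀ {k r} → 2 ℕ.≤ k → 1 ℕ.≤ r → r ℕ.≤ k ∸ 2 → α k ≤ satShare k r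
α≤satShare {2} _ (s≤s _) ()
α≤satShare {suc (suc (suc i))} {r} 2≤k 1≤r r≤k-2 = begin
  α (3 ℕ.+ i)                 ≡⟨ α-value ⟩
  + (1 ℕ.+ 2 ℕ.* m) / suc d   ≤⟨ /-mono-≤ d (ℕ.n≤1+n (1 ℕ.+ 2 ℕ.* m)) ⟩
  + (2 ℕ.+ 2 ℕ.* m) / suc d   ≡⟨ sym (satShare-value (2 ℕ.+ 2 ℕ.* m) i (factor i)) ⟩
  satShare (3 ℕ.+ i) (suc i)  ≤⟨ satShare-antitone 2≤k 1≤r r≤k-2 ⟩
  satShare (3 ℕ.+ i) r ∎
  where
  m : ℕ
  m = suc i
  open TokenValues m
  open ≤-Reasoning
  factor : ∀ i → 2 ℕ.* suc i ℕ.* (2 ℕ.+ i) ≡ (2 ℕ.+ 2 ℕ.* suc i) ℕ.* suc i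
  factor = solve-∀

fullCenterToken≤centerShare : ∀ k {r} → r ℕ.≤ k ∸ 1 → fullCenterToken k ≤ centerShare k r
fullCenterToken≤centerShare k r≤k-1 =
  +-monoʳ-≤ 1ℚ (neg-antimono-≤ (*-monoʳ-≤-nonNeg (α k) {{α-nonNeg k}} (ℕtoℚ-mono r≤k-1)))

fullSatToken≤recip : ∀ {k r} → 2 ℕ.≤ k → 1 ℕ.≤ r → r ℕ.≤ k → fullSatToken k ≤ recip r
fullSatToken≤recip {suc (suc m)} {r} (s≤s (s≤s _)) 1≤r r≤k = begin
  fullSatToken (2 ℕ.+ m)  ≡⟨ fullSatToken-value ⟩
  + (2 ℕ.* m) / suc d     ≤⟨ /-≤ (2 ℕ.* m) d 1 (suc m) (ℕ.≤-trans (ℕ.m≤m+n _ 1) (ℕ.≤-reflexive (bound m))) ⟩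
  recip (2 ℕ.+ m)         ≤⟨ recip-antitone 1≤r r≤k ⟩
  recip r ∎
  where
  open TokenValues m
  open ≤-Reasoning
  bound : ∀ m → 2 ℕ.* m ℕ.* (2 ℕ.+ m) ℕ.+ 1 ≡ 1 ℕ.* suc (2 ℕ.* m ℕ.* m ℕ.+ 4 ℕ.* m)
  bound = solve-∀

fullCenterToken≤fullSatToken : ∀ {k} → 2 ℕ.≤ k → fullCenterToken k ≤ fullSatToken k
fullCenterToken≤fullSatToken {suc (suc m)} (s≤s (s≤s _)) = begin
  fullCenterToken (2 ℕ.+ m)  ≡⟨ fullCenterToken-value ⟩
  + m / suc d                ≤⟨ /-mono-≤ d (ℕ.m≤m+n m (m ℕ.+ 0)) ⟩
  + (2 ℕ.* m) / suc d        ≡⟨ sym fullSatToken-value ⟩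
  fullSatToken (2 ℕ.+ m) ∎
  where open TokenValues m; open ≤-Reasoning

-- This identity is the equation that determines α.
fullSatToken≡2*fullCenterToken : ∀ {k} → 2 ℕ.≤ k → fullSatToken k ≡ fullCenterToken k + fullCenterToken k
fullSatToken≡2*fullCenterToken {suc (suc m)} (s≤s (s≤s _)) = begin
  fullSatToken (2 ℕ.+ m)     ≡⟨ fullSatToken-value ⟩
  + (2 ℕ.* m) / suc d        ≡⟨ cong (λ p → + (m ℕ.+ p) / suc d) (ℕ.+-identityʳ m) ⟩
  + (m ℕ.+ m) / suc d        ≡⟨ sym (/-+-same m m d) ⟩
  + m / suc d + + m / suc d  ≡⟨ sym (cong₂ _+_ fullCenterToken-value fullCenterToken-value) ⟩
  fullCenterToken (2 ℕ.+ m) + fullCenterToken (2 ℕ.+ m) ∎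
  where open TokenValues m; open ≡-Reasoning

α≤fullSatToken+fullCenterToken : ∀ {k} → 3 ℕ.≤ k → α k ≤ fullSatToken k + fullCenterToken k
α≤fullSatToken+fullCenterToken {suc (suc m)} (s≤s (s≤s 1≤m)) = begin
  α (2 ℕ.+ m)                        ≡⟨ α-value ⟩
  + (1 ℕ.+ 2 ℕ.* m) / suc d          ≤⟨ /-mono-≤ d 1+2m≤3m ⟩
  + (2 ℕ.* m ℕ.+ m) / suc d          ≡⟨ sym (/-+-same (2 ℕ.* m) m d) ⟩
  + (2 ℕ.* m) / suc d + + m / suc d  ≡⟨ sym (cong₂ _+_ fullSatToken-value fullCenterToken-value) ⟩
  fullSatToken (2 ℕ.+ m) + fullCenterToken (2 ℕ.+ m) ∎
  where
  open TokenValues m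
  open ≤-Reasoning
  1+2m≤3m : 1 ℕ.+ 2 ℕ.* m ℕ.≤ 2 ℕ.* m ℕ.+ m
  1+2m≤3m = subst (1 ℕ.+ 2 ℕ.* m ℕ.≤_) (ℕ.+-comm m (2 ℕ.* m)) (ℕ.+-monoˡ-≤ (2 ℕ.* m) 1≤m)

module _ {k : ℕ} (3≤k : 3 ℕ.≤ k) where

  private
    sat ctr : ℚ
    sat = fullSatToken k
    ctr = fullCenterToken k

    ctr≤ : ∀ {b} {Y : Set} → sat ≤ b ⊎ (ctr ≤ b × Y) → ctr ≤ b
    ctr≤ (inj₁ sat≤b) = ≤-trans (fullCenterToken≤fullSatToken (ℕ.<⇒≤ 3≤k)) sat≤b
    ctr≤ (inj₂ (ctr≤b , _)) = ctr≤b

  three-vertex-bound : ∀ {b₁ b₂ b₃} {X Y Z : Set}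
    → α k ≤ b₁ ⊎ (sat ≤ b₁ × X) → sat ≤ b₂ ⊎ (ctr ≤ b₂ × Y) → sat ≤ b₃ ⊎ (ctr ≤ b₃ × Z)
    → ¬ (X × Y × Z) → α k + sat ≤ b₁ + (b₂ + b₃)
  three-vertex-bound {b₁} {b₂} {b₃} (inj₁ α≤b₁) r₂ r₃ _ = begin
    α k + sat          ≡⟨ cong (λ p → α k + p) (fullSatToken≡2*fullCenterToken (ℕ.<⇒≤ 3≤k)) ⟩
    α k + (ctr + ctr)  ≤⟨ +-mono-≤ α≤b₁ (+-mono-≤ (ctr≤ r₂) (ctr≤ r₃)) ⟩
    b₁ + (b₂ + b₃) ∎
    where open ≤-Reasoning
  three-vertex-bound {b₁} {b₂} {b₃} (inj₂ (sat≤b₁ , _)) (inj₁ sat≤b₂) r₃ _ = begin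
    α k + sat          ≤⟨ +-monoˡ-≤ sat (α≤fullSatToken+fullCenterToken 3≤k) ⟩
    (sat + ctr) + sat  ≡⟨ +-comm (sat + ctr) sat ⟩
    sat + (sat + ctr)  ≤⟨ +-mono-≤ sat≤b₁ (+-mono-≤ sat≤b₂ (ctr≤ r₃)) ⟩
    b₁ + (b₂ + b₃) ∎
    where open ≤-Reasoning
  three-vertex-bound {b₁} {b₂} {b₃} (inj₂ (sat≤b₁ , _)) (inj₂ (ctr≤b₂ , _)) (inj₁ sat≤b₃) _ = begin
    α k + sat          ≤⟨ +-monoˡ-≤ sat (α≤fullSatToken+fullCenterToken 3≤k) ⟩
    (sat + ctr) + sat  ≡⟨ +-assoc sat ctr sat ⟩
    sat + (ctr + sat)  ≤⟨ +-mono-≤ sat≤b₁ (+-mono-≤ ctr≤b₂ sat≤b₃) ⟩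
    b₁ + (b₂ + b₃) ∎
    where open ≤-Reasoning
  three-vertex-bound (inj₂ (_ , x)) (inj₂ (_ , y)) (inj₂ (_ , z)) ¬xyz = ⊥-elim (¬xyz (x , y , z))

-- Stars of a partition and critical vertices

module _ {n : ℕ} where

  ∈-vertices⁺ : ∀ {P u} {x : Fin n} → u ∈ P → x ∈ verts u → x ∈ concatMap verts P
  ∈-vertices⁺ u∈P x∈u = ∈-concatMap⁺ verts (lose u∈P x∈u)

  ∈-vertices⁻ : ∀ P {x : Fin n} → x ∈ concatMap verts P → ∃[ u ] u ∈ P × x ∈ verts u
  ∈-vertices⁻ P x∈P = find (∈-concatMap⁻ verts {xs = P} x∈P)

  star-of-vertex-unique : ∀ {P u u'} {x : Fin n} → Unique (concatMap verts P)
    → u ∈ P → u' ∈ P → x ∈ verts u → x ∈ verts u' → u ≡ u'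
  star-of-vertex-unique {t ∷ P} _ (here refl) (here refl) _ _ = refl
  star-of-vertex-unique {t ∷ P} disj (here refl) (there u'∈P) x∈t x∈u' =
    ⊥-elim (Unique-++⇒∉ (verts t) disj x∈t (∈-vertices⁺ u'∈P x∈u'))
  star-of-vertex-unique {t ∷ P} disj (there u∈P) (here refl) x∈u x∈t =
    ⊥-elim (Unique-++⇒∉ (verts t) disj x∈t (∈-vertices⁺ u∈P x∈u))
  star-of-vertex-unique {t ∷ P} disj (there u∈P) (there u'∈P) =
    star-of-vertex-unique (Unique-++⁻ʳ (verts t) disj) u∈P u'∈P

  ∈ᵇ⁺ : {x : Fin n} → x ∈ xs → T (x ∈ᵇ xs)
  ∈ᵇ⁺ {x = x} x∈xs = any⁺ _ (Any.map (does⁺ (x Fin.≟ _)) x∈xs)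

  ∈ᵇ⁻ : {x : Fin n} → T (x ∈ᵇ xs) → x ∈ xs
  ∈ᵇ⁻ {xs = xs} t = Any.map (does⁻ (_ Fin.≟ _)) (any⁻ _ xs t)

  ∉ᵇ : {x : Fin n} → x ∉ xs → x ∈ᵇ xs ≡ false
  ∉ᵇ x∉xs = ¬T⇒≡false (x∉xs ∘ ∈ᵇ⁻)

FormTwoStar : ∀ {n} → List (Star n) → Fin n → Fin n → Set
FormTwoStar S x y = (x ─ (y ∷ [])) ∈ S ⊎ (y ─ (x ∷ [])) ∈ S

module _ {n : ℕ} {S : List (Star n)} where

  CriticalBy : Star n → Fin n → Set
  CriticalBy u x = (size u ≡ 2 × x ∈ verts u) ⊎ (size u ≡ 3 × center u ≡ x)

  critical⁺ : ∀ {u x} → u ∈ S → CriticalBy u x → Critical S x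
  critical⁺ {u} u∈S (inj₁ (size≡2 , x∈u)) = any⁺ _ (lose u∈S (Equivalence.from T-∨ (inj₁
    (Equivalence.from T-∧ (does⁺ (size u ℕ.≟ 2) size≡2 , ∈ᵇ⁺ x∈u)))))
  critical⁺ {u} u∈S (inj₂ (size≡3 , c≡x)) = any⁺ _ (lose u∈S (Equivalence.from T-∨ (inj₂
    (Equivalence.from T-∧ (does⁺ (size u ℕ.≟ 3) size≡3 , does⁺ (center u Fin.≟ _) c≡x)))))

  critical⁻ : ∀ {x} → Critical S x → ∃[ u ] u ∈ S × CriticalBy u x
  critical⁻ cx with find (any⁻ _ S cx)
  ... | u , u∈S , t with Equivalence.to T-∨ t
  ...   | inj₁ t₂ = let size≡2 , x∈u = Equivalence.to T-∧ t₂ in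
    u , u∈S , inj₁ (does⁻ (size u ℕ.≟ 2) size≡2 , ∈ᵇ⁻ x∈u)
  ...   | inj₂ t₃ = let size≡3 , c≡x = Equivalence.to T-∧ t₃ in
    u , u∈S , inj₂ (does⁻ (size u ℕ.≟ 3) size≡3 , does⁻ (center u Fin.≟ _) c≡x)

  center-critical : ∀ {c a b} → (c ─ (a ∷ b ∷ [])) ∈ S → Critical S c
  center-critical s∈S = critical⁺ s∈S (inj₂ (refl , refl))

  form-two-star : ∀ {u x y} → u ∈ S → size u ≡ 2 → x ∈ verts u → y ∈ verts u → x ≢ y → FormTwoStar S x y
  form-two-star {_ ─ (_ ∷ [])} _ refl (here refl) (here refl) x≢y = ⊥-elim (x≢y refl)
  form-two-star {_ ─ (_ ∷ [])} u∈S refl (here refl) (there (here refl)) _ = inj₁ u∈S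
  form-two-star {_ ─ (_ ∷ [])} u∈S refl (there (here refl)) (here refl) _ = inj₂ u∈S
  form-two-star {_ ─ (_ ∷ [])} _ refl (there (here refl)) (there (here refl)) x≢y = ⊥-elim (x≢y refl)

  module _ (disjS : Unique (concatMap verts S)) where
    open DecMembership (Fin._≟_ {n}) using (_∈?_)

    critical-in-star : ∀ {u x} → Critical S x → u ∈ S → x ∈ verts u → CriticalBy u x
    critical-in-star cx u∈S x∈u with critical⁻ cx
    ... | u' , u'∈S , inj₁ (size≡2 , x∈u')
      rewrite star-of-vertex-unique disjS u'∈S u∈S x∈u' x∈u = inj₁ (size≡2 , x∈u)
    ... | u' , u'∈S , inj₂ (size≡3 , refl)
      rewrite star-of-vertex-unique disjS u'∈S u∈S (here refl) x∈u = inj₂ (size≡3 , refl)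

    satellite-not-critical : ∀ {c a b x} → (c ─ (a ∷ b ∷ [])) ∈ S → Unique (c ∷ a ∷ b ∷ [])
      → x ∈ a ∷ b ∷ [] → ¬ Critical S x
    satellite-not-critical s∈S (c∉sats ∷ _) x∈sats cx with critical-in-star cx s∈S (there x∈sats)
    ... | inj₂ (_ , c≡x) = All.lookup c∉sats x∈sats c≡x

    critical-pair : ∀ {x y} → Critical S x → Critical S y → x ≢ y → Separate S x y ⊎ FormTwoStar S x y
    critical-pair {x} {y} cx cy x≢y with Any.any? (λ u → (x ∈? verts u) ×-dec (y ∈? verts u)) S
    ... | no ¬shared = inj₁ (λ u u∈S both → ¬shared (lose u∈S both))
    ... | yes shared with find shared
    ...   | u , u∈S , x∈u , y∈u with critical-in-star cx u∈S x∈u | critical-in-star cy u∈S y∈u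
    ...     | inj₁ (size≡2 , _) | _ = inj₂ (form-two-star u∈S size≡2 x∈u y∈u x≢y)
    ...     | inj₂ _ | inj₁ (size≡2 , _) = inj₂ (form-two-star u∈S size≡2 x∈u y∈u x≢y)
    ...     | inj₂ (_ , c≡x) | inj₂ (_ , c≡y) = ⊥-elim (x≢y (trans (sym c≡x) c≡y))

-- Tokens

module _ {n : ℕ} (k : ℕ) (S : List (Star n)) where

  -- Normalising a goal that mentions tokFrom unfolds the gcd computations inside the rational
  -- token values, which makes with and rewrite on such goals very slow. The token rules are
  -- therefore read off for abstract values, and case analysis uses if-elim and case_of_.
  private
    rule : (cc ac dx mx : Bool) (a s ce r : ℚ) → ℚ
    rule cc ac dx mx a s ce r =
      if cc then (if dx then a else if mx then s else 0ℚ)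
      else if ac then (if dx then ce else if mx then a else 0ℚ)
      else (if dx ∨ mx then r else 0ℚ)

    ruleAt : Fin n → Fin n → List (Fin n) → Bool → Bool → ℚ
    ruleAt c y ys dx mx = rule (isCrit S c) (any (isCrit S) (y ∷ ys)) dx mx
      (α k) (satShare k (suc (length ys))) (centerShare k (suc (length ys))) (recip (suc (suc (length ys))))

    tokFrom-rule : ∀ c y ys x → tokFrom k S (c ─ (y ∷ ys)) x ≡ ruleAt c y ys (does (c Fin.≟ x)) (x ∈ᵇ (y ∷ ys))
    tokFrom-rule c y ys x = refl

  tokFrom-single : ∀ c → tokFrom k S (c ─ []) c ≡ α k
  tokFrom-single c = cong (λ d → if d then α k else 0ℚ) (dec-true (c Fin.≟ c) refl)

  tokFrom-center : ∀ c y ys → tokFrom k S (c ─ (y ∷ ys)) c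
    ≡ (if isCrit S c then α k
       else if any (isCrit S) (y ∷ ys) then centerShare k (suc (length ys))
       else recip (suc (suc (length ys))))
  tokFrom-center c y ys = trans (tokFrom-rule c y ys c)
    (cong (λ d → ruleAt c y ys d (c ∈ᵇ (y ∷ ys))) (dec-true (c Fin.≟ c) refl))

  tokFrom-sat : ∀ {c y ys x} → x ∈ y ∷ ys → c ≢ x → tokFrom k S (c ─ (y ∷ ys)) x
    ≡ (if isCrit S c then satShare k (suc (length ys))
       else if any (isCrit S) (y ∷ ys) then α k
       else recip (suc (suc (length ys))))
  tokFrom-sat {c} {y} {ys} {x} x∈sats c≢x = trans (tokFrom-rule c y ys x)
    (cong₂ (ruleAt c y ys) (dec-false (c Fin.≟ x) c≢x) (Equivalence.to T-≡ (∈ᵇ⁺ x∈sats)))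

  tokFrom-outside : ∀ t {x} → x ∉ verts t → tokFrom k S t x ≡ 0ℚ
  tokFrom-outside (c ─ []) {x} x∉t =
    cong (λ d → if d then α k else 0ℚ) (dec-false (c Fin.≟ x) (x∉t ∘ here ∘ sym))
  tokFrom-outside (c ─ (y ∷ ys)) {x} x∉t = begin
    tokFrom k S (c ─ (y ∷ ys)) x
      ≡⟨ tokFrom-rule c y ys x ⟩
    ruleAt c y ys (does (c Fin.≟ x)) (x ∈ᵇ (y ∷ ys))
      ≡⟨ cong₂ (ruleAt c y ys) (dec-false (c Fin.≟ x) (x∉t ∘ here ∘ sym)) (∉ᵇ (x∉t ∘ there)) ⟩
    ruleAt c y ys false false
      ≡⟨ all-zero (isCrit S c) (any (isCrit S) (y ∷ ys)) ⟩
    0ℚ ∎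
    where
    open ≡-Reasoning
    all-zero : ∀ cc ac → (if cc then 0ℚ else if ac then 0ℚ else 0ℚ) ≡ 0ℚ
    all-zero true  _     = refl
    all-zero false true  = refl
    all-zero false false = refl

  token-outside : ∀ Q {x} → (∀ {t} → t ∈ Q → x ∉ verts t) → token k S Q x ≡ 0ℚ
  token-outside [] _ = refl
  token-outside (t ∷ Q) x∉Q = cong₂ _+_ (tokFrom-outside t (x∉Q (here refl))) (token-outside Q (x∉Q ∘ there))

  token-in-star : ∀ {Q t x} → Unique (concatMap verts Q) → t ∈ Q → x ∈ verts t → token k S Q x ≡ tokFrom k S t x
  token-in-star {t ∷ Q} {x = x} disjQ (here refl) x∈t = begin
    tokFrom k S t x + token k S Q x  ≡⟨ cong (λ z → tokFrom k S t x + z) (token-outside Q x∉Q) ⟩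
    tokFrom k S t x + 0ℚ             ≡⟨ +-identityʳ (tokFrom k S t x) ⟩
    tokFrom k S t x ∎
    where
    open ≡-Reasoning
    x∉Q : ∀ {t'} → t' ∈ Q → x ∉ verts t'
    x∉Q t'∈Q x∈t' = Unique-++⇒∉ (verts t) disjQ x∈t (∈-vertices⁺ t'∈Q x∈t')
  token-in-star {t' ∷ Q} {t} {x} disjQ (there t∈Q) x∈t = begin
    tokFrom k S t' x + token k S Q x  ≡⟨ cong (_+ token k S Q x) (tokFrom-outside t' x∉t') ⟩
    0ℚ + token k S Q x                ≡⟨ +-identityˡ (token k S Q x) ⟩
    token k S Q x                     ≡⟨ token-in-star (Unique-++⁻ʳ (verts t') disjQ) t∈Q x∈t ⟩
    tokFrom k S t x ∎
    where
    open ≡-Reasoning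
    x∉t' : x ∉ verts t'
    x∉t' x∈t' = Unique-++⇒∉ (verts t') disjQ x∈t' (∈-vertices⁺ t∈Q x∈t)

  module _ (2≤k : 2 ℕ.≤ k) where

    critical-token : ∀ t {x} → size t ℕ.≤ k → Unique (verts t) → x ∈ verts t → Critical S x
      → α k ≤ tokFrom k S t x
        ⊎ (fullSatToken k ≤ tokFrom k S t x × x ∈ sats t × Critical S (center t))
    critical-token (c ─ []) _ _ (here refl) _ = inj₁ (≤-reflexive (sym (tokFrom-single c)))
    critical-token (c ─ (y ∷ ys)) _ _ (here refl) cc =
      inj₁ (≤-reflexive (sym (trans (tokFrom-center c y ys) (cong (if_then _ else _) (Equivalence.to T-≡ cc)))))
    critical-token (c ─ (y ∷ ys)) {x} size≤k (c∉sats ∷ _) (there x∈sats) cx =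
      subst Bound (sym (tokFrom-sat x∈sats (All.lookup c∉sats x∈sats)))
        (if-elim Bound (isCrit S c) critical-center noncritical-center)
      where
      m : ℕ
      m = suc (length ys)
      Bound : ℚ → Set
      Bound v = α k ≤ v ⊎ (fullSatToken k ≤ v × x ∈ y ∷ ys × Critical S c)
      critical-center : isCrit S c ≡ true → Bound (satShare k m)
      critical-center cc = case m ℕ.≤? k ∸ 2 of λ where
        (yes m≤k-2) → inj₁ (α≤satShare 2≤k (s≤s z≤n) m≤k-2)
        (no _) → inj₂ (satShare-antitone 2≤k (s≤s z≤n) (ℕ.∸-monoˡ-≤ 1 size≤k) , x∈sats , Equivalence.from T-≡ cc)
      noncritical-center : isCrit S c ≡ false → Bound (if any (isCrit S) (y ∷ ys) then α k else recip (suc m))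
      noncritical-center _ =
        inj₁ (≤-reflexive (sym (cong (if_then _ else _) (Equivalence.to T-≡ (any⁺ (isCrit S) (lose x∈sats cx))))))

    noncritical-token : ∀ t {x} → size t ℕ.≤ k → Unique (verts t) → x ∈ verts t → ¬ Critical S x
      → fullSatToken k ≤ tokFrom k S t x
        ⊎ (fullCenterToken k ≤ tokFrom k S t x × center t ≡ x × ∃[ w ] w ∈ sats t × Critical S w)
    noncritical-token (c ─ []) _ _ (here refl) _ =
      inj₁ (≤-trans (fullSatToken≤α 2≤k) (≤-reflexive (sym (tokFrom-single c))))
    noncritical-token (c ─ (y ∷ ys)) size≤k _ (here refl) ¬cc =
      subst Bound (sym (trans (tokFrom-center c y ys) (cong (if_then _ else _) (¬T⇒≡false ¬cc))))
        (if-elim Bound (any (isCrit S) (y ∷ ys)) critical-sat no-critical-sat)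
      where
      m : ℕ
      m = suc (length ys)
      Bound : ℚ → Set
      Bound v = fullSatToken k ≤ v ⊎ (fullCenterToken k ≤ v × c ≡ c × ∃[ w ] w ∈ y ∷ ys × Critical S w)
      critical-sat : any (isCrit S) (y ∷ ys) ≡ true → Bound (centerShare k m)
      critical-sat ac = inj₂ (fullCenterToken≤centerShare k (ℕ.∸-monoˡ-≤ 1 size≤k) , refl ,
                              find (any⁻ (isCrit S) (y ∷ ys) (Equivalence.from T-≡ ac)))
      no-critical-sat : any (isCrit S) (y ∷ ys) ≡ false → Bound (recip (suc m))
      no-critical-sat _ = inj₁ (fullSatToken≤recip 2≤k (s≤s z≤n) size≤k)
    noncritical-token (c ─ (y ∷ ys)) size≤k (c∉sats ∷ _) (there x∈sats) _ =
      inj₁ (subst (fullSatToken k ≤_) (sym (tokFrom-sat x∈sats (All.lookup c∉sats x∈sats)))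
        (if-both (fullSatToken k ≤_) (isCrit S c) (satShare-antitone 2≤k (s≤s z≤n) (ℕ.∸-monoˡ-≤ 1 size≤k))
          (if-both (fullSatToken k ≤_) (any (isCrit S) (y ∷ ys)) (fullSatToken≤α 2≤k)
            (fullSatToken≤recip 2≤k (s≤s z≤n) size≤k))))

-- Regular 3-stars

module _ {n : ℕ} {G : Graph n} {S Q : List (Star n)}
  (disjS : Unique (concatMap verts S)) (disjQ : Unique (concatMap verts Q)) (starsQ : All (IsStarIn G) Q) where

  critical≢noncritical : ∀ {x y} → Critical S x → ¬ Critical S y → x ≢ y
  critical≢noncritical cx ¬cy refl = ¬cy cx

  distinct-stars-disjoint : ∀ {t t' x y} → t ∈ Q → t' ∈ Q → x ∈ verts t → y ∈ verts t' → t ≢ t' → x ≢ y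
  distinct-stars-disjoint t∈Q t'∈Q x∈t y∈t' t≢t' refl = t≢t' (star-of-vertex-unique disjQ t∈Q t'∈Q x∈t y∈t')

  sat-adjacent : ∀ {t w} → t ∈ Q → w ∈ sats t → Adj G (center t) w
  sat-adjacent t∈Q w∈t = All.lookup (proj₁ (All.lookup starsQ t∈Q)) w∈t

  sat-QEdge : ∀ {t w} → t ∈ Q → w ∈ sats t → QEdge Q w (center t)
  sat-QEdge {t} t∈Q w∈t = t , t∈Q , inj₂ (refl , w∈t)

  center-QEdge : ∀ {t w} → t ∈ Q → w ∈ sats t → QEdge Q (center t) w
  center-QEdge {t} t∈Q w∈t = t , t∈Q , inj₁ (refl , w∈t)

  module _ {v₁ v₂ v₃ : Fin n} (C1 : IsQSat Q v₁ × IsQCenter Q v₂ × IsQCenter Q v₃) where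

    two-star⇒special : ∀ {vi vj x y} → vi ∈ v₁ ∷ v₂ ∷ v₃ ∷ [] → vj ∈ v₁ ∷ v₂ ∷ v₃ ∷ []
      → QEdge Q vi x → QEdge Q vj y → FormTwoStar S x y → Special3 S Q (v₁ ─ (v₂ ∷ v₃ ∷ []))
    two-star⇒special {vi} {vj} {x} {y} vi∈s vj∈s vix vjy (inj₁ xy∈S) =
      v₁ , v₂ , v₃ , refl , x , y , xy∈S , C1 , vi , vj , vi∈s , vj∈s , vix , vjy
    two-star⇒special {vi} {vj} {x} {y} vi∈s vj∈s vix vjy (inj₂ yx∈S) =
      v₁ , v₂ , v₃ , refl , y , x , yx∈S , C1 , vj , vi , vj∈s , vi∈s , vjy , vix

    regular⇒separate : ¬ Special3 S Q (v₁ ─ (v₂ ∷ v₃ ∷ [])) → ∀ {vi vj x y}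
      → vi ∈ v₁ ∷ v₂ ∷ v₃ ∷ [] → vj ∈ v₁ ∷ v₂ ∷ v₃ ∷ []
      → QEdge Q vi x → QEdge Q vj y → Critical S x → Critical S y → x ≢ y → Separate S x y
    regular⇒separate regular vi∈s vj∈s vix vjy cx cy x≢y with critical-pair disjS cx cy x≢y
    ... | inj₁ separate = separate
    ... | inj₂ two-star = ⊥-elim (regular (two-star⇒special vi∈s vj∈s vix vjy two-star))

  regular-3star-not-all-exceptional : ¬ Op2Applicable G S
    → ∀ {v₁ v₂ v₃ t₁ t₂ t₃} → (v₁ ─ (v₂ ∷ v₃ ∷ [])) ∈ S → Unique (v₁ ∷ v₂ ∷ v₃ ∷ [])
    → ¬ Special3 S Q (v₁ ─ (v₂ ∷ v₃ ∷ []))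
    → t₁ ∈ Q → t₂ ∈ Q → t₃ ∈ Q
    → v₁ ∈ sats t₁ × Critical S (center t₁)
    → center t₂ ≡ v₂ × ∃[ w ] w ∈ sats t₂ × Critical S w
    → center t₃ ≡ v₃ × ∃[ w ] w ∈ sats t₃ × Critical S w
    → ⊥
  regular-3star-not-all-exceptional ¬op2 {v₁} {t₁ = t₁} {t₂} {t₃} s∈S uniq@(_ ∷ (v₂≢v₃ ∷ []) ∷ _) regular
    t₁∈Q t₂∈Q t₃∈Q (v₁∈t₁ , cc) (refl , w₂ , w₂∈t₂ , cw₂) (refl , w₃ , w₃∈t₃ , cw₃) =
    ¬op2 (v₁ ─ (v₂ ∷ v₃ ∷ []) , s∈S , inj₂ (inj₁ refl) , c ∷ w₂ ∷ w₃ ∷ [] ,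
          adjacent , cc ∷ cw₂ ∷ cw₃ ∷ [] , c∉s ∷ w₂∉s ∷ w₃∉s ∷ [] , separated)
    where
    c v₂ v₃ : Fin n
    c = center t₁
    v₂ = center t₂
    v₃ = center t₃

    ¬cv₂ : ¬ Critical S v₂
    ¬cv₂ = satellite-not-critical disjS s∈S uniq (here refl)
    ¬cv₃ : ¬ Critical S v₃
    ¬cv₃ = satellite-not-critical disjS s∈S uniq (there (here refl))

    t₁≢t₂ : t₁ ≢ t₂
    t₁≢t₂ refl = ¬cv₂ cc
    t₁≢t₃ : t₁ ≢ t₃
    t₁≢t₃ refl = ¬cv₃ cc
    t₂≢t₃ : t₂ ≢ t₃
    t₂≢t₃ refl = v₂≢v₃ refl

    adjacent : Pointwise (Adj G) (v₁ ∷ v₂ ∷ v₃ ∷ []) (c ∷ w₂ ∷ w₃ ∷ [])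
    adjacent = Graph.sym G (sat-adjacent t₁∈Q v₁∈t₁) ∷ sat-adjacent t₂∈Q w₂∈t₂ ∷ sat-adjacent t₃∈Q w₃∈t₃ ∷ []

    c≢v₁ : c ≢ v₁
    c≢v₁ refl = Graph.irrefl G (sat-adjacent t₁∈Q v₁∈t₁)

    c∉s : c ∉ v₁ ∷ v₂ ∷ v₃ ∷ []
    c∉s = All¬⇒¬Any (c≢v₁ ∷ critical≢noncritical cc ¬cv₂ ∷ critical≢noncritical cc ¬cv₃ ∷ [])
    w₂∉s : w₂ ∉ v₁ ∷ v₂ ∷ v₃ ∷ []
    w₂∉s = All¬⇒¬Any (distinct-stars-disjoint t₂∈Q t₁∈Q (there w₂∈t₂) (there v₁∈t₁) (t₁≢t₂ ∘ sym)
                      ∷ critical≢noncritical cw₂ ¬cv₂ ∷ critical≢noncritical cw₂ ¬cv₃ ∷ [])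
    w₃∉s : w₃ ∉ v₁ ∷ v₂ ∷ v₃ ∷ []
    w₃∉s = All¬⇒¬Any (distinct-stars-disjoint t₃∈Q t₁∈Q (there w₃∈t₃) (there v₁∈t₁) (t₁≢t₃ ∘ sym)
                      ∷ critical≢noncritical cw₃ ¬cv₂ ∷ critical≢noncritical cw₃ ¬cv₃ ∷ [])

    c≢w₂ : c ≢ w₂
    c≢w₂ = distinct-stars-disjoint t₁∈Q t₂∈Q (here refl) (there w₂∈t₂) t₁≢t₂
    c≢w₃ : c ≢ w₃
    c≢w₃ = distinct-stars-disjoint t₁∈Q t₃∈Q (here refl) (there w₃∈t₃) t₁≢t₃
    w₂≢w₃ : w₂ ≢ w₃
    w₂≢w₃ = distinct-stars-disjoint t₂∈Q t₃∈Q (there w₂∈t₂) (there w₃∈t₃) t₂≢t₃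

    separated : AllPairs (Separate S) (c ∷ w₂ ∷ w₃ ∷ [])
    separated =
      (separate v₁∈s v₂∈s qe₁ qe₂ cc cw₂ c≢w₂ ∷ separate v₁∈s v₃∈s qe₁ qe₃ cc cw₃ c≢w₃ ∷ [])
      ∷ (separate v₂∈s v₃∈s qe₂ qe₃ cw₂ cw₃ w₂≢w₃ ∷ [])
      ∷ [] ∷ []
      where
      separate : ∀ {vi vj x y} → vi ∈ v₁ ∷ v₂ ∷ v₃ ∷ [] → vj ∈ v₁ ∷ v₂ ∷ v₃ ∷ []
        → QEdge Q vi x → QEdge Q vj y → Critical S x → Critical S y → x ≢ y → Separate S x y
      separate = regular⇒separate ((t₁ , t₁∈Q , v₁∈t₁) , (t₂ , t₂∈Q , refl) , (t₃ , t₃∈Q , refl)) regular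
      v₁∈s : v₁ ∈ v₁ ∷ v₂ ∷ v₃ ∷ []
      v₁∈s = here refl
      v₂∈s : v₂ ∈ v₁ ∷ v₂ ∷ v₃ ∷ []
      v₂∈s = there (here refl)
      v₃∈s : v₃ ∈ v₁ ∷ v₂ ∷ v₃ ∷ []
      v₃∈s = there (there (here refl))
      qe₁ : QEdge Q v₁ c
      qe₁ = sat-QEdge t₁∈Q v₁∈t₁
      qe₂ : QEdge Q v₂ w₂
      qe₂ = center-QEdge t₂∈Q w₂∈t₂
      qe₃ : QEdge Q v₃ w₃
      qe₃ = center-QEdge t₃∈Q w₃∈t₃

  regular-3star-token : ∀ {k} → 3 ℕ.≤ k → All (λ t → size t ℕ.≤ k) Q → ¬ Op2Applicable G S
    → ∀ {v₁ v₂ v₃} → (v₁ ─ (v₂ ∷ v₃ ∷ [])) ∈ S → Unique (v₁ ∷ v₂ ∷ v₃ ∷ [])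
    → ¬ Special3 S Q (v₁ ─ (v₂ ∷ v₃ ∷ []))
    → (∃[ t ] t ∈ Q × v₁ ∈ verts t) → (∃[ t ] t ∈ Q × v₂ ∈ verts t) → (∃[ t ] t ∈ Q × v₃ ∈ verts t)
    → α k + fullSatToken k ≤ starToken k S Q (v₁ ─ (v₂ ∷ v₃ ∷ []))
  regular-3star-token {k} 3≤k sizesQ ¬op2 {v₁} {v₂} {v₃} s∈S uniq regular
    (t₁ , t₁∈Q , v₁∈t₁) (t₂ , t₂∈Q , v₂∈t₂) (t₃ , t₃∈Q , v₃∈t₃) = begin
    α k + fullSatToken k
      ≤⟨ three-vertex-bound 3≤k
           (critical-token k S 2≤k t₁ (All.lookup sizesQ t₁∈Q) (uniqueQ t₁∈Q) v₁∈t₁ (center-critical s∈S))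
           (noncritical-token k S 2≤k t₂ (All.lookup sizesQ t₂∈Q) (uniqueQ t₂∈Q) v₂∈t₂
              (satellite-not-critical disjS s∈S uniq (here refl)))
           (noncritical-token k S 2≤k t₃ (All.lookup sizesQ t₃∈Q) (uniqueQ t₃∈Q) v₃∈t₃
              (satellite-not-critical disjS s∈S uniq (there (here refl))))
           (λ (x , y , z) → regular-3star-not-all-exceptional ¬op2 s∈S uniq regular t₁∈Q t₂∈Q t₃∈Q x y z) ⟩
    tokFrom k S t₁ v₁ + (tokFrom k S t₂ v₂ + tokFrom k S t₃ v₃)
      ≡⟨ sym (cong₂ _+_ (token-in-star k S disjQ t₁∈Q v₁∈t₁)
               (cong₂ _+_ (token-in-star k S disjQ t₂∈Q v₂∈t₂)
                 (trans (+-identityʳ (token k S Q v₃)) (token-in-star k S disjQ t₃∈Q v₃∈t₃)))) ⟩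
    starToken k S Q (v₁ ─ (v₂ ∷ v₃ ∷ [])) ∎
    where
    open ≤-Reasoning
    2≤k : 2 ℕ.≤ k
    2≤k = ℕ.<⇒≤ 3≤k
    uniqueQ : ∀ {t} → t ∈ Q → Unique (verts t)
    uniqueQ t∈Q = proj₂ (All.lookup starsQ t∈Q)

lemma11 : (k : ℕ) → 4 ℕ.≤ k → (n : ℕ) → (G : Graph n)
    → (S Q : List (Star n))
    → IsStarPartition G k S
    → (∀ P → IsStarPartition G k P → num1Stars S ℕ.≤ num1Stars P)
    → ¬ Op1Applicable G S → ¬ Op2Applicable G S → ¬ Op3Applicable k G S
    → IsStarPartition G k Q
    → (∀ P → IsStarPartition G k P → length Q ℕ.≤ length P)
    → (s : Star n) → s ∈ S → size s ≡ 3 → ¬ Special3 S Q s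
    → α k + (1ℚ - α k) * recip (k ∸ 1) ≤ starToken k S Q s
lemma11 _ _ _ _ _ _ _ _ _ _ _ _ _ (_ ─ []) _ () _
lemma11 _ _ _ _ _ _ _ _ _ _ _ _ _ (_ ─ (_ ∷ [])) _ () _
lemma11 _ _ _ _ _ _ _ _ _ _ _ _ _ (_ ─ (_ ∷ _ ∷ _ ∷ _)) _ () _
lemma11 k 4≤k n G S Q (starsS , _ , disjS , _) _ _ ¬op2 _ (starsQ , sizesQ , disjQ , coverQ) _
  (v₁ ─ (v₂ ∷ v₃ ∷ [])) s∈S refl regular =
  regular-3star-token {G = G} disjS disjQ starsQ (ℕ.≤-trans (ℕ.n≤1+n 3) 4≤k) sizesQ ¬op2 s∈S
    (proj₂ (All.lookup starsS s∈S)) regular (star-of v₁) (star-of v₂) (star-of v₃)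
  where
  star-of : ∀ v → ∃[ t ] t ∈ Q × v ∈ verts t
  star-of v = ∈-vertices⁻ Q (coverQ v)
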